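{- Let $\mathbf{Q}=(Q,\leq,i)$ be a finite involutive poset and let $\mathbf{Q}'=(Q',\leq',i')$ be its De Morgan unification core. Then: (i) if $u\colon\mathbf{P}\to\mathbf{Q}$ is a De Morgan unifier for $\mathbf{Q}$, then $u(P)\subseteq Q'$ and $u$, regarded as a map $\mathbf{P}\to\mathbf{Q}'$, is a De Morgan unifier for $\mathbf{Q}'$; (ii) the preordered classes $U_{\mathcal{M}}(\mathbf{Q})$ and $U_{\mathcal{M}}(\mathbf{Q}')$ are equivalent.
   Context: A finite involutive poset is $(P,\leq,i)$ with $(P,\leq)$ a finite poset and $i\colon P\to P$ satisfying $x\leq y\Rightarrow i(y)\leq i(x)$ and $i(i(x))=x$; morphisms are monotone maps commuting with the involutions. For $(P,\leq,i)$: $(M_1)$ $(P,\leq)$ is a nonempty lattice; $(M_2)$ every $x$ with $x\leq i(x)$ has some $y$ with $x\leq y=i(y)$; $(M_3)$ $S=\{x\in P\mid x\leq i(x)\}$ with inherited order is $3$-complete (whenever $X\subseteq S$ is such that every $Y\subseteq X$ with $|Y|<3$ has an upper bound in $S$, $\bigvee X$ exists in $S$). A De Morgan unifier for $\mathbf{Q}$ is a morphism $u\colon\mathbf{P}\to\mathbf{Q}$ of finite involutive posets where $\mathbf{P}$ satisfies $(M_1),(M_2),(M_3)$; $u_2\leq u_1$ iff $u_1\circ f=u_2$ for some morphism $f$ between their domains; $U_{\mathcal{M}}(\mathbf{Q})$ is this preordered class. The De Morgan unification core of $\mathbf{Q}$ is $\mathbf{Q}'=(Q',\leq',i')$ with $Q'=\{x,i(x)\mid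 x\in Q,\ \text{there are } y,z\in Q \text{ with } z=i(z) \text{ and } y\leq z,\ y\leq x,\ y\leq i(x)\}$, $\leq'$ the restriction of $\leq$, and $i'$ the restriction of $i$. -}

module Defs where

open import Data.Nat using (ℕ; _<_)
open import Data.Fin using (Fin)
open import Data.List using (List; length)
open import Data.List.Membership.Propositional using (_∈_)
open import Data.Product using (Σ; ∃; ∃-syntax; _×_; _,_; proj₁; proj₂)
open import Data.Sum using (_⊎_; inj₁; inj₂)
open import Function.Bundles using (_↔_)
open import Relation.Binary.Structures using (IsPartialOrder; IsPreorder)
open import Relation.Binary.PropositionalEquality
  using (_≡_; refl; sym; trans; cong; isEquivalence)

record InvPoset : Set₁ where
  field
    Carrier        : Set
    _≤_            : Carrier → Carrier → Set
    isPartialOrder : IsPartialOrder _≡_ _≤_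
    inv            : Carrier → Carrier
    inv-antitone   : ∀ {x y} → x ≤ y → inv y ≤ inv x
    inv-invol      : ∀ x → inv (inv x) ≡ x

open InvPoset public using () renaming (Carrier to ∣_∣)

Finite : InvPoset → Set
Finite P = ∃[ n ] (∣ P ∣ ↔ Fin n)

record IsMorphism (P Q : InvPoset) (f : ∣ P ∣ → ∣ Q ∣) : Set where
  private
    module P = InvPoset P
    module Q = InvPoset Q
  field
    monotone : ∀ {x y} → x P.≤ y → f x Q.≤ f y
    inv-comm : ∀ x → f (P.inv x) ≡ Q.inv (f x)

record Hom (P Q : InvPoset) : Set where
  field
    fun        : ∣ P ∣ → ∣ Q ∣
    isMorphism : IsMorphism P Q fun

module _ (P : InvPoset) where
  open InvPoset P

  IsSup : Carrier → Carrier → Carrier → Set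
  IsSup x y s = x ≤ s × y ≤ s × (∀ t → x ≤ t → y ≤ t → s ≤ t)

  IsInf : Carrier → Carrier → Carrier → Set
  IsInf x y m = m ≤ x × m ≤ y × (∀ t → t ≤ x → t ≤ y → t ≤ m)

  -- (M1): (P, ≤) is a nonempty lattice
  M1 : Set
  M1 = Carrier × (∀ x y → ∃[ s ] IsSup x y s × ∃[ m ] IsInf x y m)

  M2 : Set
  M2 = ∀ x → x ≤ inv x → ∃[ y ] (x ≤ y × y ≡ inv y)

  S : Carrier → Set
  S x = x ≤ inv x

  FewerThan3 : (Carrier → Set) → Set
  FewerThan3 Y = ∃[ ys ] (length ys < 3 × (∀ y → (Y y → y ∈ ys) × (y ∈ ys → Y y)))

  -- (M3): S with the inherited order is 3-complete
  M3 : Set₁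
  M3 = ∀ (X : Carrier → Set) → (∀ x → X x → S x) →
       (∀ (Y : Carrier → Set) → (∀ y → Y y → X y) → FewerThan3 Y →
          ∃[ s ] (S s × (∀ y → Y y → y ≤ s))) →
       ∃[ j ] (S j × (∀ x → X x → x ≤ j)
                   × (∀ t → S t → (∀ x → X x → x ≤ t) → j ≤ t))

record DMUnifier (Q : InvPoset) : Set₁ where
  field
    dom        : InvPoset
    dom-finite : Finite dom
    m1         : M1 dom
    m2         : M2 dom
    m3         : M3 dom
    map        : ∣ dom ∣ → ∣ Q ∣
    isMorphism : IsMorphism dom Q map

open DMUnifier public

_⊑_ : ∀ {Q} → DMUnifier Q → DMUnifier Q → Set
u₂ ⊑ u₁ = Σ (Hom (dom u₂) (dom u₁)) λ f → ∀ x → map u₁ (Hom.fun f x) ≡ map u₂ x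

record PreorderEquiv {A B : Set₁} (_≤A_ : A → A → Set) (_≤B_ : B → B → Set) : Set₁ where
  field
    F      : A → B
    G      : B → A
    F-mono : ∀ {a a'} → a ≤A a' → F a ≤B F a'
    G-mono : ∀ {b b'} → b ≤B b' → G b ≤A G b'
    GF     : ∀ a → (G (F a) ≤A a) × (a ≤A G (F a))
    FG     : ∀ b → (F (G b) ≤B b) × (b ≤B F (G b))

module _ (Q : InvPoset) where
  open InvPoset Q

  CoreCond : Carrier → Set
  CoreCond x = ∃[ y ] ∃[ z ] (z ≡ inv z × y ≤ z × y ≤ x × y ≤ inv x)

  InCore : Carrier → Set
  InCore w = ∃[ x ] (CoreCond x × (w ≡ x ⊎ w ≡ inv x))

  -- elements of Q' (membership proof is irrelevant, so equality is that of Q)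
  record CoreEl : Set where
    constructor ⟨_,_⟩
    field
      elem      : Carrier
      .inCore   : InCore elem

  open CoreEl

  InCore-inv : ∀ w → InCore w → InCore (inv w)
  InCore-inv w (x , c , inj₁ e) = x , c , inj₂ (cong inv e)
  InCore-inv w (x , c , inj₂ e) = x , c , inj₁ (trans (cong inv e) (inv-invol x))

  CoreEl-≡ : ∀ {a b : CoreEl} → elem a ≡ elem b → a ≡ b
  CoreEl-≡ {⟨ x , p ⟩} {⟨ .x , q ⟩} refl = refl

  private
    module PO = IsPartialOrder isPartialOrder

    _≤'_ : CoreEl → CoreEl → Set
    a ≤' b = elem a ≤ elem b

    inv' : CoreEl → CoreEl
    inv' ⟨ x , p ⟩ = ⟨ inv x , InCore-inv x p ⟩

    isPO' : IsPartialOrder _≡_ _≤'_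
    isPO' = record
      { isPreorder = record
        { isEquivalence = isEquivalence
        ; reflexive = λ { refl → PO.refl }
        ; trans = PO.trans }
      ; antisym = λ p q → CoreEl-≡ (PO.antisym p q) }

  Core : InvPoset
  Core = record
    { Carrier = CoreEl
    ; _≤_ = _≤'_
    ; isPartialOrder = isPO'
    ; inv = inv'
    ; inv-antitone = inv-antitone
    ; inv-invol = λ a → CoreEl-≡ (inv-invol (elem a))
    }

module Submission where

-- In a lattice P satisfying (M2), every element x satisfies
-- the core condition: the meet m = x ∧ i(x) lies in S (m ≤ x ≤ i(m)), so
-- by (M2) it sits below a fixed point z = i(z).  Morphisms of involutive
-- posets transport such witnesses, so every element in the image of a
-- De Morgan unifier u : P → Q satisfies the core condition in Q; this is
-- part (i), and u corestricts to a morphism P → Q'.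
-- For part (ii) the corestriction F and the postcomposition G with the
-- inclusion Q' → Q keep the domain of a unifier and do not change its
-- underlying function, so both are monotone for ⊑ and both composites
-- G ∘ F and F ∘ G return their argument (definitionally); reflexivity of
-- ⊑ then gives the required isomorphisms.

open import Defs
open import Data.Product using (Σ; _×_; _,_; proj₁; proj₂)
open import Data.Sum using (inj₁)
open import Relation.Binary.Structures using (IsPartialOrder)
open import Relation.Binary.PropositionalEquality using (_≡_; refl; cong; subst)

-- In a lattice satisfying (M2) every element satisfies the core condition,
-- witnessed by y = x ∧ i(x) and a fixed point above it.
CoreCond-of-M1-M2 : (P : InvPoset) → M1 P → M2 P → ∀ x → CoreCond P x
CoreCond-of-M1-M2 P (_ , lattice) m2 x = meet , z , z≡iz , meet≤z , meet≤x , meet≤ix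
  where
    open InvPoset P
    module PO = IsPartialOrder isPartialOrder
    meet    = proj₁ (proj₂ (proj₂ (lattice x (inv x))))
    isMeet  = proj₂ (proj₂ (proj₂ (lattice x (inv x))))
    meet≤x  = proj₁ isMeet
    meet≤ix = proj₁ (proj₂ isMeet)

    -- x = i(i(x)) ≤ i(meet), since meet ≤ i(x)
    x≤imeet : x ≤ inv meet
    x≤imeet = subst (_≤ inv meet) (inv-invol x) (inv-antitone meet≤ix)

    meet∈S : meet ≤ inv meet
    meet∈S = PO.trans meet≤x x≤imeet

    z      = proj₁ (m2 meet meet∈S)
    meet≤z = proj₁ (proj₂ (m2 meet meet∈S))
    z≡iz   = proj₂ (proj₂ (m2 meet meet∈S))

CoreCond-preserved : (P Q : InvPoset) (f : ∣ P ∣ → ∣ Q ∣) → IsMorphism P Q f →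
                     ∀ {x} → CoreCond P x → CoreCond Q (f x)
CoreCond-preserved P Q f mor {x} (y , z , z≡iz , y≤z , y≤x , y≤ix) =
  f y , f z , fz≡ifz , monotone y≤z , monotone y≤x , fy≤ifx
  where
    open IsMorphism mor
    open InvPoset Q using (_≤_; inv)

    fz≡ifz : f z ≡ inv (f z)
    fz≡ifz = subst (λ w → f z ≡ w) (inv-comm z) (cong f z≡iz)

    fy≤ifx : f y ≤ inv (f x)
    fy≤ifx = subst (f y ≤_) (inv-comm x) (monotone y≤ix)

module _ (Q : InvPoset) where

  unifier-in-core : (u : DMUnifier Q) → ∀ x → InCore Q (map u x)
  unifier-in-core u x =
    map u x , CoreCond-preserved (dom u) Q (map u) (isMorphism u)
                (CoreCond-of-M1-M2 (dom u) (m1 u) (m2 u) x) , inj₁ refl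

  corestrict-isMorphism : (P : InvPoset) (f : ∣ P ∣ → ∣ Q ∣) (mor : IsMorphism P Q f)
                          (inCore : ∀ x → InCore Q (f x)) →
                          IsMorphism P (Core Q) (λ x → ⟨ f x , inCore x ⟩)
  corestrict-isMorphism P f mor inCore = record
    { monotone = IsMorphism.monotone mor
    ; inv-comm = λ x → CoreEl-≡ Q (IsMorphism.inv-comm mor x) }

  inclusion : Hom (Core Q) Q
  inclusion = record
    { fun        = CoreEl.elem
    ; isMorphism = record { monotone = λ p → p ; inv-comm = λ _ → refl } }

  corestrict : DMUnifier Q → DMUnifier (Core Q)
  corestrict u = record
    { dom = dom u ; dom-finite = dom-finite u ; m1 = m1 u ; m2 = m2 u ; m3 = m3 u
    ; map        = λ x → ⟨ map u x , unifier-in-core u x ⟩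
    ; isMorphism = corestrict-isMorphism (dom u) (map u) (isMorphism u) (unifier-in-core u) }

  corestrict-mono : ∀ {u v} → u ⊑ v → corestrict u ⊑ corestrict v
  corestrict-mono (f , commutes) = f , λ x → CoreEl-≡ Q (commutes x)

∘-isMorphism : (P Q R : InvPoset) (g : ∣ Q ∣ → ∣ R ∣) (f : ∣ P ∣ → ∣ Q ∣) →
               IsMorphism Q R g → IsMorphism P Q f → IsMorphism P R (λ x → g (f x))
∘-isMorphism P Q R g f g-mor f-mor = record
  { monotone = λ p → IsMorphism.monotone g-mor (IsMorphism.monotone f-mor p)
  ; inv-comm = λ x → subst (λ w → g (f (InvPoset.inv P x)) ≡ w)
                           (IsMorphism.inv-comm g-mor (f x))
                           (cong g (IsMorphism.inv-comm f-mor x)) }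

pushforward : {Q R : InvPoset} → Hom Q R → DMUnifier Q → DMUnifier R
pushforward {Q} {R} g u = record
  { dom = dom u ; dom-finite = dom-finite u ; m1 = m1 u ; m2 = m2 u ; m3 = m3 u
  ; map        = λ x → Hom.fun g (map u x)
  ; isMorphism = ∘-isMorphism (dom u) Q R (Hom.fun g) (map u) (Hom.isMorphism g) (isMorphism u) }

pushforward-mono : {Q R : InvPoset} (g : Hom Q R) {u v : DMUnifier Q} →
                   u ⊑ v → pushforward g u ⊑ pushforward g v
pushforward-mono g (f , commutes) = f , λ x → cong (Hom.fun g) (commutes x)

⊑-refl : {Q : InvPoset} (u : DMUnifier Q) → u ⊑ u
⊑-refl u = record { fun = λ x → x ; isMorphism = record { monotone = λ p → p ; inv-comm = λ _ → refl } }
         , λ _ → refl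

-- Corestriction and inclusion are mutually inverse up to definitional
-- equality, so the composites are isomorphic to the identities by ⊑-refl.
lemma29 : (Q : InvPoset) → Finite Q →
    ((u : DMUnifier Q) →
      Σ (∀ x → InCore Q (map u x))
        (λ h → IsMorphism (dom u) (Core Q) (λ x → ⟨ map u x , h x ⟩)))
    × PreorderEquiv (_⊑_ {Q}) (_⊑_ {Core Q})
lemma29 Q _ = part-i , part-ii
  where
    part-i : (u : DMUnifier Q) →
             Σ (∀ x → InCore Q (map u x))
               (λ h → IsMorphism (dom u) (Core Q) (λ x → ⟨ map u x , h x ⟩))
    part-i u = unifier-in-core Q u , isMorphism (corestrict Q u)

    part-ii : PreorderEquiv (_⊑_ {Q}) (_⊑_ {Core Q})
    part-ii = record
      { F      = corestrict Q
      ; G      = pushforward (inclusion Q)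
      ; F-mono = λ {u} {v} → corestrict-mono Q {u} {v}
      ; G-mono = λ {u} {v} → pushforward-mono (inclusion Q) {u} {v}
      ; GF     = λ u → ⊑-refl u , ⊑-refl u
      ; FG     = λ v → ⊑-refl v , ⊑-refl v }
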